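{- Let $\mathcal G$ be a strongly regular graph with degree $\delta$ and parameters $\lambda$ and $\mu$. If \[ \lambda>\tfrac12\left(\lambda-\mu+\sqrt{(\lambda-\mu)^2+4(\delta-\mu)}\right), \] then the neighbourhood graph $\mathcal G_u$ of every vertex $u\in V(\mathcal G)$ is connected.
   Context: A strongly regular graph with parameters $(\delta,\lambda,\mu)$ is a connected $\delta$-regular simple graph in which every two adjacent vertices have exactly $\lambda$ common neighbours and every two non-adjacent vertices have exactly $\mu\geq 1$ common neighbours. The neighbourhood graph $\mathcal G_u$ of a vertex $u$ is the induced subgraph on the set of neighbours of $u$. -}

module Defs where

open import Data.Nat using (ℕ; zero; suc; _+_; _≥_)
open import Data.Bool using (Bool; true; false; if_then_else_; _∧_)
open import Data.Fin using (Fin; zero; suc)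
open import Data.Unit using (⊤)
open import Relation.Binary.PropositionalEquality using (_≡_; _≢_)

record SimpleGraph (n : ℕ) : Set where
  field
    Adj    : Fin n → Fin n → Bool
    sym    : ∀ x y → Adj x y ≡ Adj y x
    irrefl : ∀ x → Adj x x ≡ false
open SimpleGraph public

count : {n : ℕ} → (Fin n → Bool) → ℕ
count {zero}  f = 0
count {suc n} f = (if f zero then 1 else 0) + count (λ i → f (suc i))

degree : {n : ℕ} → SimpleGraph n → Fin n → ℕ
degree G x = count (λ w → Adj G x w)

commonNeighbours : {n : ℕ} → SimpleGraph n → Fin n → Fin n → ℕ
commonNeighbours G x y = count (λ w → Adj G x w ∧ Adj G y w)

data WalkIn {n : ℕ} (G : SimpleGraph n) (P : Fin n → Set) : Fin n → Fin n → Set where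
  stop : ∀ {x} → P x → WalkIn G P x x
  step : ∀ {x y z} → P x → Adj G x y ≡ true → WalkIn G P y z → WalkIn G P x z

Connected : {n : ℕ} → SimpleGraph n → Set
Connected G = ∀ x y → WalkIn G (λ _ → ⊤) x y

NeighbourhoodConnected : {n : ℕ} → SimpleGraph n → Fin n → Set
NeighbourhoodConnected G u =
  ∀ x y → Adj G u x ≡ true → Adj G u y ≡ true → WalkIn G (λ w → Adj G u w ≡ true) x y

record StronglyRegular {n : ℕ} (G : SimpleGraph n) (δ λ' μ : ℕ) : Set where
  field
    connected : Connected G
    regular   : ∀ x → degree G x ≡ δ
    adjCommon : ∀ x y → Adj G x y ≡ true → commonNeighbours G x y ≡ λ'
    nonAdjCommon : ∀ x y → x ≢ y → Adj G x y ≡ false → commonNeighbours G x y ≡ μ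
    μ≥1       : μ ≥ 1

module Submission where

-- The hypothesis λ > (λ - μ + √((λ-μ)² + 4(δ-μ)))/2 is equivalent to δ < μ(1 + λ)
-- (module SpectralCondition).  So it suffices to show: if the neighbourhood graph G_u
-- is disconnected, then μ(1 + λ) ≤ δ.  This is a variance (double counting) argument.
-- Split the neighbours of u into a connected component C of G_u and the rest D, both
-- unions of components, of sizes c, d ≥ 1.  Every vertex of a union of components S
-- has exactly λ neighbours in S, so the SRG identity A² = δI + λA + μ(J - I - A) gives
--   Σ_w |N(w) ∩ S|² = |S| (δ + λ² + μ(|S| - 1 - λ))   and   Σ_w |N(w)∩C| |N(w)∩D| = c d μ.
-- Expanding Σ_w (d |N(w)∩C| - c |N(w)∩D|)² ≥ Σ_{w ∈ C} (dλ)² + Σ_{w ∈ D} (cλ)² with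
-- these values and dividing by c d (c + d) yields μ(1 + λ) ≤ δ.

open import Defs renaming (sym to Adj-sym)

module VertexSets where
  open import Data.Nat using (ℕ; zero; suc; _+_; _*_; _≤_; z≤n; s≤s)
  open import Data.Nat.Properties
    using (+-*-semiring; +-mono-≤; +-monoʳ-≤; +-cancelʳ-≤; +-cancelˡ-≡; ≤-antisym; ≤-trans;
           ≤-reflexive; m≤n+m; *-zeroʳ; *-identityʳ; +-identityʳ; *-distribˡ-+)
  open import Data.Bool using (Bool; true; false; if_then_else_; _∧_)
  open import Data.Fin using (Fin; zero; suc; _≟_)
  open import Data.Product using (_×_; _,_; proj₁; proj₂)
  open import Relation.Nullary using (does)
  open import Relation.Binary.PropositionalEquality using (_≡_; refl; sym; trans; cong; cong₂; module ≡-Reasoning)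
  open import Algebra.Properties.Semiring.Sum +-*-semiring public
    using (sum; sum-syntax; sum-cong-≗; ∑-distrib-+; ∑-comm; *-distribˡ-sum; *-distribʳ-sum)

  𝟙 : Bool → ℕ
  𝟙 b = if b then 1 else 0

  _⊆_ : ∀ {n} → (Fin n → Bool) → (Fin n → Bool) → Set
  P ⊆ Q = ∀ i → P i ≡ true → Q i ≡ true

  [_≐_] : ∀ {n} → Fin n → Fin n → ℕ
  [ x ≐ y ] = 𝟙 (does (x ≟ y))

  𝟙-∧ : ∀ a b → 𝟙 (a ∧ b) ≡ 𝟙 a * 𝟙 b
  𝟙-∧ false b = refl
  𝟙-∧ true false = refl
  𝟙-∧ true true = refl

  𝟙-mono : ∀ {a b} → (a ≡ true → b ≡ true) → 𝟙 a ≤ 𝟙 b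
  𝟙-mono {false} _ = z≤n
  𝟙-mono {true} a⇒b rewrite a⇒b refl = s≤s z≤n

  𝟙-injective : ∀ {a b} → 𝟙 a ≡ 𝟙 b → a ≡ b
  𝟙-injective {false} {false} _ = refl
  𝟙-injective {true} {true} _ = refl

  true-iff⇒≡ : ∀ {a b} → (a ≡ true → b ≡ true) → (b ≡ true → a ≡ true) → a ≡ b
  true-iff⇒≡ {false} {false} _ _ = refl
  true-iff⇒≡ {false} {true} _ b⇒a = b⇒a refl
  true-iff⇒≡ {true} {false} a⇒b _ = sym (a⇒b refl)
  true-iff⇒≡ {true} {true} _ _ = refl

  count≡∑ : ∀ {n} (P : Fin n → Bool) → count P ≡ ∑[ i < n ] 𝟙 (P i)
  count≡∑ {zero} P = refl
  count≡∑ {suc n} P = cong (𝟙 (P zero) +_) (count≡∑ (λ i → P (suc i)))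

  count-cong : ∀ {n} {P Q : Fin n → Bool} → (∀ i → P i ≡ Q i) → count P ≡ count Q
  count-cong {n} {P} {Q} P≡Q =
    trans (count≡∑ P) (trans (sum-cong-≗ (λ i → cong 𝟙 (P≡Q i))) (sym (count≡∑ Q)))

  count-≤ : ∀ {n} (P : Fin n → Bool) → count P ≤ n
  count-≤ {zero} P = z≤n
  count-≤ {suc n} P = +-mono-≤ (𝟙-mono {b = true} (λ _ → refl)) (count-≤ (λ i → P (suc i)))

  count-pos : ∀ {n} (P : Fin n → Bool) {i : Fin n} → P i ≡ true → 1 ≤ count P
  count-pos P {zero} Pi rewrite Pi = s≤s z≤n
  count-pos P {suc i} Pi = ≤-trans (count-pos (λ j → P (suc j)) Pi) (m≤n+m _ _)

  count-mono : ∀ {n} {P Q : Fin n → Bool} → P ⊆ Q → count P ≤ count Q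
  count-mono {zero} _ = z≤n
  count-mono {suc n} P⊆Q = +-mono-≤ (𝟙-mono (P⊆Q zero)) (count-mono (λ i → P⊆Q (suc i)))

  +-split : ∀ {a b c d} → a ≤ b → c ≤ d → a + c ≡ b + d → a ≡ b × c ≡ d
  +-split {a} {b} {c} {d} a≤b c≤d eq = a≡b , +-cancelˡ-≡ a c d (trans eq (cong (_+ d) (sym a≡b)))
    where
    a≡b : a ≡ b
    a≡b = ≤-antisym a≤b (+-cancelʳ-≤ c b a (≤-trans (+-monoʳ-≤ b c≤d) (≤-reflexive (sym eq))))

  count-≡⇒⊇ : ∀ {n} {P Q : Fin n → Bool} → P ⊆ Q → count P ≡ count Q → Q ⊆ P
  count-≡⇒⊇ {suc n} {P} {Q} P⊆Q same
    with +-split (𝟙-mono (P⊆Q zero)) (count-mono (λ i → P⊆Q (suc i))) same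
  ... | same-head , same-tail = λ where
    zero Q0 → trans (𝟙-injective same-head) Q0
    (suc i) → count-≡⇒⊇ (λ j → P⊆Q (suc j)) same-tail i

  ∑-mono : ∀ {n} {f g : Fin n → ℕ} → (∀ i → f i ≤ g i) → sum f ≤ sum g
  ∑-mono {zero} _ = z≤n
  ∑-mono {suc n} f≤g = +-mono-≤ (f≤g zero) (∑-mono (λ i → f≤g (suc i)))

  ∑-zero : ∀ {n} (f : Fin n → ℕ) → (∀ i → f i ≡ 0) → sum f ≡ 0
  ∑-zero {zero} f _ = refl
  ∑-zero {suc n} f f≡0 = cong₂ _+_ (f≡0 zero) (∑-zero (λ i → f (suc i)) (λ i → f≡0 (suc i)))

  ∑-select : ∀ {n} (f : Fin n → ℕ) (x : Fin n) → ∑[ y < n ] (f y * [ x ≐ y ]) ≡ f x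
  ∑-select {suc n} f zero =
    trans (cong₂ _+_ (*-identityʳ (f zero)) (∑-zero _ (λ i → *-zeroʳ (f (suc i)))))
          (+-identityʳ (f zero))
  ∑-select {suc n} f (suc x) =
    cong₂ _+_ (*-zeroʳ (f zero)) (∑-select (λ i → f (suc i)) x)

  ∑-on-set : ∀ {n} (S : Fin n → Bool) (F : Fin n → ℕ) {b : ℕ} →
    (∀ x → S x ≡ true → F x ≡ b) → ∑[ x < n ] (𝟙 (S x) * F x) ≡ count S * b
  ∑-on-set {n} S F {b} F≡b = begin
    ∑[ x < n ] (𝟙 (S x) * F x) ≡⟨ sum-cong-≗ on-S ⟩
    ∑[ x < n ] (𝟙 (S x) * b)   ≡⟨ sym (*-distribʳ-sum b (λ x → 𝟙 (S x))) ⟩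
    (∑[ x < n ] 𝟙 (S x)) * b   ≡⟨ cong (_* b) (sym (count≡∑ S)) ⟩
    count S * b                ∎
    where
    open ≡-Reasoning
    on-S : ∀ x → 𝟙 (S x) * F x ≡ 𝟙 (S x) * b
    on-S x with S x in Sx
    ... | false = refl
    ... | true = cong (_+ 0) (F≡b x Sx)

  ∑-lin : ∀ {n} (g h k : Fin n → ℕ) b c →
    ∑[ i < n ] (g i + b * h i + c * k i) ≡ sum g + b * sum h + c * sum k
  ∑-lin g h k b c =
    trans (∑-distrib-+ (λ i → g i + b * h i) (λ i → c * k i))
          (cong₂ _+_ (trans (∑-distrib-+ g (λ i → b * h i)) (cong (sum g +_) (sym (*-distribˡ-sum b h))))
                     (sym (*-distribˡ-sum c k)))

  ∑-on-set-+ : ∀ {n} (S : Fin n → Bool) (F : Fin n → ℕ) {a b : ℕ} →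
    (∀ x → S x ≡ true → F x + a ≡ b) → ∑[ x < n ] (𝟙 (S x) * F x) + count S * a ≡ count S * b
  ∑-on-set-+ {n} S F {a} {b} F+a≡b = begin
    ∑[ x < n ] (𝟙 (S x) * F x) + count S * a
      ≡⟨ cong (∑[ x < n ] (𝟙 (S x) * F x) +_) (sym (∑-on-set S (λ _ → a) (λ _ _ → refl))) ⟩
    ∑[ x < n ] (𝟙 (S x) * F x) + ∑[ x < n ] (𝟙 (S x) * a)
      ≡⟨ sym (∑-distrib-+ (λ x → 𝟙 (S x) * F x) (λ x → 𝟙 (S x) * a)) ⟩
    ∑[ x < n ] (𝟙 (S x) * F x + 𝟙 (S x) * a)
      ≡⟨ sum-cong-≗ (λ x → sym (*-distribˡ-+ (𝟙 (S x)) (F x) a)) ⟩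
    ∑[ x < n ] (𝟙 (S x) * (F x + a))
      ≡⟨ ∑-on-set S (λ x → F x + a) F+a≡b ⟩
    count S * b ∎
    where open ≡-Reasoning

  ∑-gram : ∀ {m n} (M : Fin m → Fin n → ℕ) (f g : Fin n → ℕ) →
    ∑[ w < m ] ((∑[ x < n ] (M w x * f x)) * (∑[ y < n ] (M w y * g y)))
      ≡ ∑[ x < n ] (f x * ∑[ y < n ] (g y * ∑[ w < m ] (M w x * M w y)))
  ∑-gram {m} {n} M f g = begin
    ∑[ w < m ] ((∑[ x < n ] (M w x * f x)) * (∑[ y < n ] (M w y * g y)))
      ≡⟨ sum-cong-≗ (λ w → trans (*-distribʳ-sum (∑[ y < n ] (M w y * g y)) (λ x → M w x * f x))
                                 (sum-cong-≗ (λ x → *-distribˡ-sum (M w x * f x) (λ y → M w y * g y)))) ⟩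
    ∑[ w < m ] ∑[ x < n ] ∑[ y < n ] (M w x * f x * (M w y * g y))
      ≡⟨ ∑-comm (λ w x → ∑[ y < n ] (M w x * f x * (M w y * g y))) ⟩
    ∑[ x < n ] ∑[ w < m ] ∑[ y < n ] (M w x * f x * (M w y * g y))
      ≡⟨ sum-cong-≗ (λ x → ∑-comm (λ w y → M w x * f x * (M w y * g y))) ⟩
    ∑[ x < n ] ∑[ y < n ] ∑[ w < m ] (M w x * f x * (M w y * g y))
      ≡⟨ sum-cong-≗ (λ x → sum-cong-≗ (λ y → sum-cong-≗ (λ w → regroup (M w x) (f x) (M w y) (g y)))) ⟩
    ∑[ x < n ] ∑[ y < n ] ∑[ w < m ] (f x * (g y * (M w x * M w y)))
      ≡⟨ sum-cong-≗ (λ x → sum-cong-≗ (λ y → trans (sym (*-distribˡ-sum (f x) (λ w → g y * (M w x * M w y))))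
                                                    (cong (f x *_) (sym (*-distribˡ-sum (g y) (λ w → M w x * M w y)))))) ⟩
    ∑[ x < n ] ∑[ y < n ] (f x * (g y * ∑[ w < m ] (M w x * M w y)))
      ≡⟨ sum-cong-≗ (λ x → sym (*-distribˡ-sum (f x) (λ y → g y * ∑[ w < m ] (M w x * M w y)))) ⟩
    ∑[ x < n ] (f x * ∑[ y < n ] (g y * ∑[ w < m ] (M w x * M w y))) ∎
    where
    open ≡-Reasoning
    open import Data.Nat.Tactic.RingSolver using (solve-∀)
    regroup : ∀ a b c e → a * b * (c * e) ≡ b * (e * (a * c))
    regroup = solve-∀

module NeighbourhoodComponent where
  open import Data.Nat using (ℕ; zero; suc; _≤_; z≤n; _≟_)
  open import Data.Nat.Properties using (≤∧≢⇒<; ≤-<-trans; <⇒≱)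
  open import Data.Bool using (Bool; true; false; _∧_; _∨_; not)
  open import Data.Bool.Properties using (∧-conicalˡ; ∧-conicalʳ; ∨-zeroʳ; not-injective)
  import Data.Bool.Properties as Bool
  open import Data.Fin using (Fin)
  import Data.Fin.Properties as Fin
  open import Data.Product using (∃-syntax; _×_; _,_; proj₁; proj₂)
  open import Data.Sum using (_⊎_; inj₁; inj₂; [_,_]′)
  open import Data.Empty using (⊥-elim)
  open import Function using (id)
  open import Relation.Nullary using (Dec; yes; no; does)
  open import Relation.Nullary.Decidable using (dec-true)
  open import Relation.Binary.PropositionalEquality using (_≡_; _≢_; refl; trans; cong)
  open VertexSets using (_⊆_; count-≤; count-mono; count-≡⇒⊇)

  stabilises : ∀ {n} (R : ℕ → Fin n → Bool) → (∀ k → R k ⊆ R (suc k)) → ∃[ K ] R (suc K) ⊆ R K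
  stabilises {n} R increasing =
    [ id , (λ big → ⊥-elim (<⇒≱ big (count-≤ (R (suc n))))) ]′ (grows (suc n))
    where
    grows : ∀ k → (∃[ K ] R (suc K) ⊆ R K) ⊎ k ≤ count (R k)
    grows zero = inj₂ z≤n
    grows (suc k) with grows k | count (R k) ≟ count (R (suc k))
    ... | inj₁ stable | _ = inj₁ stable
    ... | inj₂ k≤ | yes same = inj₁ (k , count-≡⇒⊇ (increasing k) same)
    ... | inj₂ k≤ | no differ = inj₂ (≤-<-trans k≤ (≤∧≢⇒< (count-mono (increasing k)) differ))

  decided : ∀ {a} {A : Set a} (A? : Dec A) → does A? ≡ true → A
  decided (yes a) _ = a

  ∧-intro : ∀ {a b} → a ≡ true → b ≡ true → a ∧ b ≡ true
  ∧-intro refl refl = refl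

  ∨-elim : ∀ a b → a ∨ b ≡ true → a ≡ true ⊎ b ≡ true
  ∨-elim true b _ = inj₁ refl
  ∨-elim false b b≡true = inj₂ b≡true

  -- S is a union of connected components of the neighbourhood graph G_u.
  record ClosedIn {n} (G : SimpleGraph n) (u : Fin n) (S : Fin n → Bool) : Set where
    field
      inside : S ⊆ Adj G u
      closed : ∀ {z v} → S z ≡ true → Adj G u v ≡ true → Adj G z v ≡ true → S v ≡ true

  complementIn : ∀ {n} → SimpleGraph n → Fin n → (Fin n → Bool) → Fin n → Bool
  complementIn G u S v = Adj G u v ∧ not (S v)

  module _ {n} {G : SimpleGraph n} {u : Fin n} {S : Fin n → Bool} (S-closed : ClosedIn G u S) where
    open ClosedIn S-closed

    outside : ∀ {v} → complementIn G u S v ≡ true → S v ≡ false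
    outside {v} Dv = not-injective (∧-conicalʳ (Adj G u v) (not (S v)) Dv)

    separated : ∀ {x y} → S x ≡ true → complementIn G u S y ≡ true → x ≢ y × Adj G x y ≡ false
    separated {x} {y} Sx Dy = (λ { refl → Bool.not-¬ Sx (outside Dy) }) , not-adjacent
      where
      not-adjacent : Adj G x y ≡ false
      not-adjacent with Adj G x y in xy
      ... | false = refl
      ... | true = ⊥-elim (Bool.not-¬ (closed Sx (∧-conicalˡ _ _ Dy) xy) (outside Dy))

    complement-closed : ClosedIn G u (complementIn G u S)
    complement-closed = record
      { inside = λ v Dv → ∧-conicalˡ _ _ Dv
      ; closed = λ {z} {v} Dz uv zv → ∧-intro uv (cong not (not-in-S Dz uv zv))
      }
      where
      not-in-S : ∀ {z v} → complementIn G u S z ≡ true → Adj G u v ≡ true → Adj G z v ≡ true → S v ≡ false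
      not-in-S {z} {v} Dz uv zv with S v in Sv
      ... | false = refl
      ... | true = ⊥-elim (Bool.not-¬ (closed Sv (∧-conicalˡ _ _ Dz) (trans (Adj-sym G v z) zv)) (outside Dz))

  -- The connected component of a vertex y of G_u, built as the limit of the sets of
  -- vertices joined to y by walks in G_u of bounded length.
  module Component {n} (G : SimpleGraph n) (u y : Fin n) (uy : Adj G u y ≡ true) where

    InGᵤ : Fin n → Set
    InGᵤ w = Adj G u w ≡ true

    attachedTo : (Fin n → Bool) → Fin n → Bool
    attachedTo P z = Adj G u z ∧ does (Fin.any? (λ v → (Adj G z v ∧ P v) Bool.≟ true))

    attached-elim : ∀ {P z} → attachedTo P z ≡ true → InGᵤ z × ∃[ v ] Adj G z v ≡ true × P v ≡ true
    attached-elim {P} {z} h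
      with decided (Fin.any? (λ v → (Adj G z v ∧ P v) Bool.≟ true)) (∧-conicalʳ _ _ h)
    ... | v , zv∧Pv = ∧-conicalˡ _ _ h , v , ∧-conicalˡ _ _ zv∧Pv , ∧-conicalʳ _ _ zv∧Pv

    attached-intro : ∀ {P z v} → InGᵤ z → Adj G z v ≡ true → P v ≡ true → attachedTo P z ≡ true
    attached-intro {P} {z} {v} uz zv Pv = ∧-intro uz (dec-true (Fin.any? _) (v , ∧-intro zv Pv))

    reach : ℕ → Fin n → Bool
    reach zero z = does (z Fin.≟ y)
    reach (suc k) z = reach k z ∨ attachedTo (reach k) z

    reach-increasing : ∀ k → reach k ⊆ reach (suc k)
    reach-increasing k z r = cong (_∨ attachedTo (reach k) z) r

    reach-walk : ∀ k z → reach k z ≡ true → WalkIn G InGᵤ z y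
    reach-walk zero z r with decided (z Fin.≟ y) r
    ... | refl = stop uy
    reach-walk (suc k) z r with ∨-elim (reach k z) _ r
    ... | inj₁ earlier = reach-walk k z earlier
    ... | inj₂ attached with attached-elim attached
    ...   | uz , v , zv , rv = step uz zv (reach-walk k v rv)

    reach-start : ∀ k → reach k y ≡ true
    reach-start zero = dec-true (y Fin.≟ y) refl
    reach-start (suc k) = cong (_∨ attachedTo (reach k) y) (reach-start k)

    stationary : ∃[ K ] reach (suc K) ⊆ reach K
    stationary = stabilises reach reach-increasing

    component : Fin n → Bool
    component = reach (proj₁ stationary)

    y∈component : component y ≡ true
    y∈component = reach-start (proj₁ stationary)

    component-walk : ∀ {z} → component z ≡ true → WalkIn G InGᵤ z y
    component-walk = reach-walk (proj₁ stationary) _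

    component-closed : ClosedIn G u component
    component-closed = record
      { inside = λ z Cz → walk-inside (component-walk Cz)
      ; closed = λ {z} {v} Cz uv zv → proj₂ stationary v
          (trans (cong (component v ∨_) (attached-intro uv (trans (Adj-sym G v z) zv) Cz)) (∨-zeroʳ _))
      }
      where
      walk-inside : ∀ {z} → WalkIn G InGᵤ z y → InGᵤ z
      walk-inside (stop uz) = uz
      walk-inside (step uz _ _) = uz

module VarianceArithmetic where
  open import Data.Nat using (ℕ; suc; _+_; _*_; _≤_)
  open import Data.Nat.Properties
    using (≤-total; m≤n⇒∃[o]m+o≡n; m≤m+n; ≤-reflexive; +-identityʳ; +-monoˡ-≤; +-cancelˡ-≤; *-cancelˡ-≤; module ≤-Reasoning)
  open import Data.Nat.Tactic.RingSolver using (solve-∀)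
  open import Data.Bool using (Bool; true; false)
  open import Data.Product using (_,_)
  open import Data.Sum using (inj₁; inj₂)
  open import Relation.Binary.PropositionalEquality using (_≡_; refl; sym; cong₂; subst)
  open VertexSets using (𝟙)

  two-products≤squares : ∀ p q → 2 * (p * q) ≤ p * p + q * q
  two-products≤squares p q with ≤-total p q
  ... | inj₁ p≤q with m≤n⇒∃[o]m+o≡n p≤q
  ...   | e , refl = subst (2 * (p * (p + e)) ≤_) (sym (expand p e)) (m≤m+n _ (e * e))
    where
    expand : ∀ p e → p * p + (p + e) * (p + e) ≡ 2 * (p * (p + e)) + e * e
    expand = solve-∀
  two-products≤squares p q | inj₂ q≤p with m≤n⇒∃[o]m+o≡n q≤p
  ...   | e , refl = subst (2 * ((q + e) * q) ≤_) (sym (expand q e)) (m≤m+n _ (e * e))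
    where
    expand : ∀ q e → (q + e) * (q + e) + q * q ≡ 2 * ((q + e) * q) + e * e
    expand = solve-∀

  square-bound : ∀ (s t : Bool) p q → (s ≡ true → q ≡ 0) → (t ≡ true → p ≡ 0) → (s ≡ true → t ≡ false) →
    2 * (p * q) + (𝟙 s * (p * p) + 𝟙 t * (q * q)) ≤ p * p + q * q
  square-bound false false p q _ _ _ =
    subst (_≤ p * p + q * q) (sym (+-identityʳ _)) (two-products≤squares p q)
  square-bound true false p q q≡0 _ _ rewrite q≡0 refl = ≤-reflexive (only-p p)
    where
    only-p : ∀ p → 2 * (p * 0) + (1 * (p * p) + 0) ≡ p * p + 0 * 0
    only-p = solve-∀
  square-bound false true p q _ p≡0 _ rewrite p≡0 refl = ≤-reflexive (only-q q)
    where
    only-q : ∀ q → 2 * (0 * q) + (0 + 1 * (q * q)) ≡ 0 * 0 + q * q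
    only-q = solve-∀
  square-bound true true p q _ _ exclusive with exclusive refl
  ... | ()

  -- The closing computation.  With c, d ≥ 1, the values of the three Gram sums and the
  -- summed pointwise bound give c d (c + d) μ (1 + λ) ≤ c d (c + d) δ.
  variance-bound : ∀ c d l μ δ Scc Sdd Scd →
    Scc + c * (μ * (1 + l)) ≡ c * (δ + l * l + μ * c) →
    Sdd + d * (μ * (1 + l)) ≡ d * (δ + l * l + μ * d) →
    Scd ≡ c * (d * μ) →
    2 * (d * c) * Scd + (c * ((d * l) * (d * l)) + d * ((c * l) * (c * l))) ≤ d * d * Scc + c * c * Sdd →
    1 ≤ c → 1 ≤ d → μ * (1 + l) ≤ δ
  variance-bound c@(suc _) d@(suc _) l μ δ Scc Sdd .(c * (d * μ)) squaresC squaresD refl bound _ _ =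
    *-cancelˡ-≤ k (+-cancelˡ-≤ Z _ _ (begin
      Z + k * m
        ≡⟨ regroup c d l μ ⟩
      2 * (d * c) * (c * (d * μ)) + (c * ((d * l) * (d * l)) + d * ((c * l) * (c * l))) + T
        ≤⟨ +-monoˡ-≤ T bound ⟩
      d * d * Scc + c * c * Sdd + T
        ≡⟨ factor c d Scc Sdd m ⟩
      d * d * (Scc + c * m) + c * c * (Sdd + d * m)
        ≡⟨ cong₂ (λ s t → d * d * s + c * c * t) squaresC squaresD ⟩
      d * d * (c * (δ + l * l + μ * c)) + c * c * (d * (δ + l * l + μ * d))
        ≡⟨ expand c d l μ δ ⟩
      Z + k * δ ∎))
    where
    open ≤-Reasoning
    m k Z T : ℕ
    m = μ * (1 + l)
    k = c * d * (c + d)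
    Z = 2 * (c * c) * (d * d) * μ + (c * d) * (c + d) * (l * l)
    T = d * d * (c * m) + c * c * (d * m)
    regroup : ∀ c d l μ →
      2 * (c * c) * (d * d) * μ + (c * d) * (c + d) * (l * l) + c * d * (c + d) * (μ * (1 + l))
        ≡ 2 * (d * c) * (c * (d * μ)) + (c * ((d * l) * (d * l)) + d * ((c * l) * (c * l)))
          + (d * d * (c * (μ * (1 + l))) + c * c * (d * (μ * (1 + l))))
    regroup = solve-∀
    factor : ∀ c d Scc Sdd m → d * d * Scc + c * c * Sdd + (d * d * (c * m) + c * c * (d * m))
                                ≡ d * d * (Scc + c * m) + c * c * (Sdd + d * m)
    factor = solve-∀
    expand : ∀ c d l μ δ → d * d * (c * (δ + l * l + μ * c)) + c * c * (d * (δ + l * l + μ * d))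
                             ≡ 2 * (c * c) * (d * d) * μ + (c * d) * (c + d) * (l * l) + c * d * (c + d) * δ
    expand = solve-∀

module StronglyRegularCounting where
  open import Data.Nat using (ℕ; _+_; _*_; _≤_)
  open import Data.Nat.Properties using (*-comm; *-identityʳ; *-zeroʳ; module ≤-Reasoning)
  open import Data.Nat.Tactic.RingSolver using (solve-∀)
  open import Data.Bool using (Bool; true; false; _∧_)
  open import Data.Bool.Properties using (∧-idem; ¬-not)
  open import Data.Fin using (Fin; _≟_)
  open import Data.Product using (proj₁; proj₂)
  open import Relation.Nullary using (yes; no)
  open import Relation.Binary.PropositionalEquality using (_≡_; refl; sym; trans; cong; cong₂; module ≡-Reasoning)
  open VertexSets
  open NeighbourhoodComponent using (ClosedIn; complementIn; separated; complement-closed)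
  open VarianceArithmetic using (square-bound; variance-bound)

  module _ {n} {G : SimpleGraph n} {δ λ' μ : ℕ} (srg : StronglyRegular G δ λ' μ) where
    open StronglyRegular srg

    adj : Fin n → Fin n → ℕ
    adj x y = 𝟙 (Adj G x y)

    degIn : (Fin n → Bool) → Fin n → ℕ
    degIn S w = ∑[ v < n ] (adj w v * 𝟙 (S v))

    common-as-sum : ∀ x y → commonNeighbours G x y ≡ ∑[ w < n ] (adj w x * adj w y)
    common-as-sum x y = trans (count≡∑ (λ w → Adj G x w ∧ Adj G y w)) (sum-cong-≗ λ w →
      trans (𝟙-∧ (Adj G x w) (Adj G y w)) (cong₂ _*_ (cong 𝟙 (Adj-sym G x w)) (cong 𝟙 (Adj-sym G y w))))

    common-self : ∀ x → commonNeighbours G x x ≡ δ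
    common-self x = trans (count-cong (λ w → ∧-idem (Adj G x w))) (regular x)

    srg-entry : ∀ x y →
      commonNeighbours G x y + μ * [ x ≐ y ] + μ * adj x y ≡ δ * [ x ≐ y ] + λ' * adj x y + μ
    srg-entry x y with x ≟ y
    ... | yes refl rewrite irrefl G x | common-self x = diagonal δ λ' μ
      where
      diagonal : ∀ δ λ' μ → δ + μ * 1 + μ * 0 ≡ δ * 1 + λ' * 0 + μ
      diagonal = solve-∀
    ... | no x≢y with Adj G x y in xy
    ...   | true rewrite adjCommon x y xy = adjacent δ λ' μ
      where
      adjacent : ∀ δ λ' μ → λ' + μ * 0 + μ * 1 ≡ δ * 0 + λ' * 1 + μ
      adjacent = solve-∀
    ...   | false rewrite nonAdjCommon x y x≢y xy = nonadjacent δ λ' μ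
      where
      nonadjacent : ∀ δ λ' μ → μ + μ * 0 + μ * 0 ≡ δ * 0 + λ' * 0 + μ
      nonadjacent = solve-∀

    srg-row : ∀ (f : Fin n → ℕ) x →
      ∑[ y < n ] (f y * commonNeighbours G x y) + μ * f x + μ * ∑[ y < n ] (adj x y * f y)
        ≡ δ * f x + λ' * ∑[ y < n ] (adj x y * f y) + μ * sum f
    srg-row f x = begin
      ∑[ y < n ] (f y * commonNeighbours G x y) + μ * f x + μ * ∑[ y < n ] (adj x y * f y)
        ≡⟨ cong (λ t → ∑[ y < n ] (f y * commonNeighbours G x y) + μ * t + μ * ∑[ y < n ] (adj x y * f y))
                (sym (∑-select f x)) ⟩
      ∑[ y < n ] (f y * commonNeighbours G x y) + μ * ∑[ y < n ] (f y * [ x ≐ y ]) + μ * ∑[ y < n ] (adj x y * f y)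
        ≡⟨ sym (∑-lin (λ y → f y * commonNeighbours G x y) (λ y → f y * [ x ≐ y ]) (λ y → adj x y * f y) μ μ) ⟩
      ∑[ y < n ] (f y * commonNeighbours G x y + μ * (f y * [ x ≐ y ]) + μ * (adj x y * f y))
        ≡⟨ sum-cong-≗ (λ y → weigh (f y) _ _ _ δ λ' μ (srg-entry x y)) ⟩
      ∑[ y < n ] (δ * (f y * [ x ≐ y ]) + λ' * (adj x y * f y) + μ * f y)
        ≡⟨ ∑-lin (λ y → δ * (f y * [ x ≐ y ])) (λ y → adj x y * f y) f λ' μ ⟩
      ∑[ y < n ] (δ * (f y * [ x ≐ y ])) + λ' * ∑[ y < n ] (adj x y * f y) + μ * sum f
        ≡⟨ cong (λ t → t + λ' * ∑[ y < n ] (adj x y * f y) + μ * sum f)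
                (trans (sym (*-distribˡ-sum δ (λ y → f y * [ x ≐ y ]))) (cong (δ *_) (∑-select f x))) ⟩
      δ * f x + λ' * ∑[ y < n ] (adj x y * f y) + μ * sum f ∎
      where
      open ≡-Reasoning
      weigh : ∀ s c e a δ λ' μ → c + μ * e + μ * a ≡ δ * e + λ' * a + μ →
              s * c + μ * (s * e) + μ * (a * s) ≡ δ * (s * e) + λ' * (a * s) + μ * s
      weigh s c e a δ λ' μ eq = begin
        s * c + μ * (s * e) + μ * (a * s) ≡⟨ factor-left s c e a μ ⟩
        s * (c + μ * e + μ * a)           ≡⟨ cong (s *_) eq ⟩
        s * (δ * e + λ' * a + μ)          ≡⟨ factor-right s e a δ λ' μ ⟩
        δ * (s * e) + λ' * (a * s) + μ * s ∎
        where
        factor-left : ∀ s c e a μ → s * c + μ * (s * e) + μ * (a * s) ≡ s * (c + μ * e + μ * a)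
        factor-left = solve-∀
        factor-right : ∀ s e a δ λ' μ → s * (δ * e + λ' * a + μ) ≡ δ * (s * e) + λ' * (a * s) + μ * s
        factor-right = solve-∀

    -- Double counting paths x - w - y with x ∈ S and y ∈ T.
    gram-common : ∀ (S T : Fin n → Bool) →
      ∑[ w < n ] (degIn S w * degIn T w)
        ≡ ∑[ x < n ] (𝟙 (S x) * ∑[ y < n ] (𝟙 (T y) * commonNeighbours G x y))
    gram-common S T = trans (∑-gram adj (λ x → 𝟙 (S x)) (λ y → 𝟙 (T y)))
      (sum-cong-≗ (λ x → cong (𝟙 (S x) *_) (sum-cong-≗ (λ y → cong (𝟙 (T y) *_) (sym (common-as-sum x y))))))

    module _ {u : Fin n} {S : Fin n → Bool} (S-closed : ClosedIn G u S) where
      open ClosedIn S-closed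

      degIn-closed : ∀ {x} → S x ≡ true → degIn S x ≡ λ'
      degIn-closed {x} Sx = begin
        degIn S x                              ≡⟨ sum-cong-≗ S-agrees ⟩
        ∑[ v < n ] (adj x v * 𝟙 (Adj G u v))   ≡⟨ sym (trans (count≡∑ (λ v → Adj G u v ∧ Adj G x v))
                                                    (sum-cong-≗ (λ v → trans (𝟙-∧ (Adj G u v) (Adj G x v)) (*-comm (𝟙 (Adj G u v)) (adj x v))))) ⟩
        commonNeighbours G u x                 ≡⟨ adjCommon u x (inside x Sx) ⟩
        λ' ∎
        where
        open ≡-Reasoning
        -- among the neighbours of x, S consists exactly of the neighbours of u
        S-agrees : ∀ v → adj x v * 𝟙 (S v) ≡ adj x v * 𝟙 (Adj G u v)
        S-agrees v with Adj G x v in xv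
        ... | false = refl
        ... | true = cong (λ b → 𝟙 b + 0) (true-iff⇒≡ (inside v) (λ uv → closed Sx uv xv))

      row-in-set : ∀ {x} → S x ≡ true →
        ∑[ y < n ] (𝟙 (S y) * commonNeighbours G x y) + μ * (1 + λ') ≡ δ + λ' * λ' + μ * count S
      row-in-set {x} Sx = begin
        R + μ * (1 + λ')                                 ≡⟨ split-μ R μ λ' ⟩
        R + μ * 1 + μ * λ'                               ≡⟨ cong₂ (λ s t → R + μ * s + μ * t)
                                                              (cong 𝟙 (sym Sx)) (sym (degIn-closed Sx)) ⟩
        R + μ * 𝟙 (S x) + μ * degIn S x                  ≡⟨ srg-row (λ y → 𝟙 (S y)) x ⟩
        δ * 𝟙 (S x) + λ' * degIn S x + μ * sum (λ y → 𝟙 (S y))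
                                                         ≡⟨ cong₂ (λ s t → δ * s + λ' * t + μ * sum (λ y → 𝟙 (S y)))
                                                              (cong 𝟙 Sx) (degIn-closed Sx) ⟩
        δ * 1 + λ' * λ' + μ * sum (λ y → 𝟙 (S y))        ≡⟨ cong₂ (λ s t → s + λ' * λ' + μ * t)
                                                              (*-identityʳ δ) (sym (count≡∑ S)) ⟩
        δ + λ' * λ' + μ * count S ∎
        where
        open ≡-Reasoning
        R : ℕ
        R = ∑[ y < n ] (𝟙 (S y) * commonNeighbours G x y)
        split-μ : ∀ R μ λ' → R + μ * (1 + λ') ≡ R + μ * 1 + μ * λ'
        split-μ = solve-∀

      squares : ∑[ w < n ] (degIn S w * degIn S w) + count S * (μ * (1 + λ'))
                  ≡ count S * (δ + λ' * λ' + μ * count S)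
      squares = trans (cong (_+ count S * (μ * (1 + λ'))) (gram-common S S))
                      (∑-on-set-+ S _ (λ x Sx → row-in-set Sx))

    degIn-empty : ∀ (T : Fin n → Bool) w → (∀ v → T v ≡ true → Adj G w v ≡ false) → degIn T w ≡ 0
    degIn-empty T w no-edge = ∑-zero (λ v → adj w v * 𝟙 (T v)) no-edge-term
      where
      no-edge-term : ∀ v → adj w v * 𝟙 (T v) ≡ 0
      no-edge-term v with T v in Tv
      ... | false = *-zeroʳ (adj w v)
      ... | true rewrite no-edge v Tv = refl

    module _ {u : Fin n} {C : Fin n → Bool} (C-closed : ClosedIn G u C) where
      private
        D : Fin n → Bool
        D = complementIn G u C
        c d : ℕ
        c = count C
        d = count D
        -- degrees into C and D, scaled so that the weight vector d·1_C - c·1_D is balanced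
        p q : Fin n → ℕ
        p w = d * degIn C w
        q w = c * degIn D w

      -- Distinct non-adjacent vertices x ∈ C, y ∈ D have μ common neighbours.
      cross : ∑[ w < n ] (degIn C w * degIn D w) ≡ c * (d * μ)
      cross = trans (gram-common C D) (∑-on-set C _ (λ x Cx → ∑-on-set D _ (λ y Dy →
        nonAdjCommon x y (proj₁ (separated C-closed Cx Dy)) (proj₂ (separated C-closed Cx Dy)))))

      vertex-bound : ∀ w → 2 * (p w * q w) + (𝟙 (C w) * (p w * p w) + 𝟙 (D w) * (q w * q w)) ≤ p w * p w + q w * q w
      vertex-bound w = square-bound (C w) (D w) (p w) (q w)
        (λ Cw → trans (cong (c *_) (degIn-empty D w (λ v Dv → proj₂ (separated C-closed Cw Dv)))) (*-zeroʳ c))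
        (λ Dw → trans (cong (d *_) (degIn-empty C w (λ v Cv →
                  trans (Adj-sym G w v) (proj₂ (separated C-closed Cv Dw))))) (*-zeroʳ d))
        (λ Cw → ¬-not (λ Dw → proj₁ (separated C-closed Cw Dw) refl))

      sum-bound :
        2 * (d * c) * ∑[ w < n ] (degIn C w * degIn D w) + (c * ((d * λ') * (d * λ')) + d * ((c * λ') * (c * λ')))
          ≤ d * d * ∑[ w < n ] (degIn C w * degIn C w) + c * c * ∑[ w < n ] (degIn D w * degIn D w)
      sum-bound = begin
        2 * (d * c) * ∑[ w < n ] (degIn C w * degIn D w) + (c * ((d * λ') * (d * λ')) + d * ((c * λ') * (c * λ')))
          ≡⟨ sym (cong₂ _+_ products (cong₂ _+_ on-C on-D)) ⟩
        ∑[ w < n ] (2 * (p w * q w)) + (∑[ w < n ] (𝟙 (C w) * (p w * p w)) + ∑[ w < n ] (𝟙 (D w) * (q w * q w)))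
          ≡⟨ sym (trans (∑-distrib-+ (λ w → 2 * (p w * q w)) _)
                        (cong (∑[ w < n ] (2 * (p w * q w)) +_) (∑-distrib-+ (λ w → 𝟙 (C w) * (p w * p w)) _))) ⟩
        ∑[ w < n ] (2 * (p w * q w) + (𝟙 (C w) * (p w * p w) + 𝟙 (D w) * (q w * q w)))
          ≤⟨ ∑-mono vertex-bound ⟩
        ∑[ w < n ] (p w * p w + q w * q w)
          ≡⟨ squares-sum ⟩
        d * d * ∑[ w < n ] (degIn C w * degIn C w) + c * c * ∑[ w < n ] (degIn D w * degIn D w) ∎
        where
        open ≤-Reasoning
        regroup : ∀ d c a b → 2 * (d * a * (c * b)) ≡ 2 * (d * c) * (a * b)
        regroup = solve-∀
        spread : ∀ d c a b → d * a * (d * a) + c * b * (c * b) ≡ d * d * (a * a) + c * c * (b * b)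
        spread = solve-∀
        products : ∑[ w < n ] (2 * (p w * q w)) ≡ 2 * (d * c) * ∑[ w < n ] (degIn C w * degIn D w)
        products = trans (sum-cong-≗ (λ w → regroup d c (degIn C w) (degIn D w)))
                         (sym (*-distribˡ-sum (2 * (d * c)) (λ w → degIn C w * degIn D w)))
        on-C : ∑[ w < n ] (𝟙 (C w) * (p w * p w)) ≡ c * ((d * λ') * (d * λ'))
        on-C = ∑-on-set C _ (λ w Cw → cong (λ t → d * t * (d * t)) (degIn-closed C-closed Cw))
        on-D : ∑[ w < n ] (𝟙 (D w) * (q w * q w)) ≡ d * ((c * λ') * (c * λ'))
        on-D = ∑-on-set D _ (λ w Dw → cong (λ t → c * t * (c * t)) (degIn-closed (complement-closed C-closed) Dw))
        squares-sum : ∑[ w < n ] (p w * p w + q w * q w)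
                        ≡ d * d * ∑[ w < n ] (degIn C w * degIn C w) + c * c * ∑[ w < n ] (degIn D w * degIn D w)
        squares-sum = trans (sum-cong-≗ (λ w → spread d c (degIn C w) (degIn D w)))
          (trans (∑-distrib-+ (λ w → d * d * (degIn C w * degIn C w)) (λ w → c * c * (degIn D w * degIn D w)))
                 (cong₂ _+_ (sym (*-distribˡ-sum (d * d) (λ w → degIn C w * degIn C w)))
                            (sym (*-distribˡ-sum (c * c) (λ w → degIn D w * degIn D w)))))

      split-bound : ∀ {y x} → C y ≡ true → D x ≡ true → μ * (1 + λ') ≤ δ
      split-bound Cy Dx = variance-bound c d λ' μ δ _ _ _
        (squares C-closed) (squares (complement-closed C-closed)) cross sum-bound
        (count-pos C Cy) (count-pos D Dx)

module NeighbourhoodConnectivity where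
  open import Data.Nat using (ℕ; _+_; _*_; _<_)
  open import Data.Nat.Properties using (<⇒≱)
  open import Data.Bool using (true; false; not)
  open import Data.Empty using (⊥-elim)
  open import Relation.Binary.PropositionalEquality using (_≡_; refl; cong)
  open NeighbourhoodComponent using (module Component; ∧-intro)
  open StronglyRegularCounting using (split-bound)

  -- Any neighbour x of u lies in the component of y, since otherwise that
  -- component and its complement split G_u.
  neighbourhood-connected : ∀ {n} {G : SimpleGraph n} {δ λ' μ : ℕ} →
    StronglyRegular G δ λ' μ → δ < μ * (1 + λ') → ∀ u → NeighbourhoodConnected G u
  neighbourhood-connected {G = G} srg δ<μ[1+λ] u x y ux uy = join (component x) refl
    where
    open Component G u y uy
    join : ∀ b → component x ≡ b → WalkIn G InGᵤ x y
    join true Cx = component-walk Cx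
    join false Cx = ⊥-elim (<⇒≱ δ<μ[1+λ]
      (split-bound srg component-closed y∈component (∧-intro ux (cong not Cx))))

module SpectralCondition where
  import Data.Nat as ℕ
  open import Data.Nat.Properties using (*-cancelˡ-<)
  open import Data.Integer using (ℤ; +_; _-_; _*_; _+_; _<_)
  open import Data.Integer.Properties using (pos-*; pos-+; +-monoʳ-<; drop‿+<+)
  open import Data.Integer.Tactic.RingSolver using (solve-∀)
  open import Relation.Binary.PropositionalEquality using (_≡_; sym; trans; cong; subst₂)

  -- With a = λ - μ, D = a² + 4(δ - μ) and x = 2λ - a = λ + μ, one has x² - D = 4(μ(1+λ) - δ);
  -- hence D < x² says exactly that δ < μ(1 + λ).
  D<x²⇒δ<μ[1+λ] : ∀ (δ λ' μ : ℕ.ℕ) →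
    (let a = + λ' - + μ
         D = a * a + + 4 * (+ δ - + μ)
         x = + 2 * + λ' - a
     in D < x * x) → δ ℕ.< μ ℕ.* (1 ℕ.+ λ')
  D<x²⇒δ<μ[1+λ] δ λ' μ D<x² = *-cancelˡ-< 4 δ (μ ℕ.* (1 ℕ.+ λ')) (drop‿+<+ (subst₂ _<_ four-δ four-μ[1+λ] shifted))
    where
    a D x : ℤ
    a = + λ' - + μ
    D = a * a + + 4 * (+ δ - + μ)
    x = + 2 * + λ' - a
    shifted : (+ 4 * + δ - D) + D < (+ 4 * + δ - D) + x * x
    shifted = +-monoʳ-< (+ 4 * + δ - D) D<x²
    cancel-D : ∀ l m d → (+ 4 * d - ((l - m) * (l - m) + + 4 * (d - m))) + ((l - m) * (l - m) + + 4 * (d - m))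
                           ≡ + 4 * d
    cancel-D = solve-∀
    gap : ∀ l m d → (+ 4 * d - ((l - m) * (l - m) + + 4 * (d - m))) + (+ 2 * l - (l - m)) * (+ 2 * l - (l - m))
                      ≡ + 4 * (m * (+ 1 + l))
    gap = solve-∀
    four-δ : (+ 4 * + δ - D) + D ≡ + (4 ℕ.* δ)
    four-δ = trans (cancel-D (+ λ') (+ μ) (+ δ)) (sym (pos-* 4 δ))
    four-μ[1+λ] : (+ 4 * + δ - D) + x * x ≡ + (4 ℕ.* (μ ℕ.* (1 ℕ.+ λ')))
    four-μ[1+λ] = trans (gap (+ λ') (+ μ) (+ δ))
      (trans (cong (λ t → + 4 * (+ μ * t)) (sym (pos-+ 1 λ')))
        (trans (cong (+ 4 *_) (sym (pos-* μ (1 ℕ.+ λ')))) (sym (pos-* 4 (μ ℕ.* (1 ℕ.+ λ'))))))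

open import Data.Nat using (ℕ)
open import Data.Integer using (ℤ; +_; _-_; _*_; _+_; _≤_; _<_)
open import Data.Fin using (Fin)
open import Data.Product using (_×_; _,_)
open NeighbourhoodConnectivity using (neighbourhood-connected)
open SpectralCondition using (D<x²⇒δ<μ[1+λ])

mainTheorem5 : (n : ℕ) (G : SimpleGraph n) (δ λ' μ : ℕ) →
    StronglyRegular G δ λ' μ →
    (let a = + λ' - + μ
         D = a * a + + 4 * (+ δ - + μ)
         x = + 2 * + λ' - a
     in (+ 0 ≤ x) × (D < x * x)) →
    (u : Fin n) → NeighbourhoodConnected G u
mainTheorem5 n G δ λ' μ srg (_ , D<x²) = neighbourhood-connected srg (D<x²⇒δ<μ[1+λ] δ λ' μ D<x²)
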